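{- Let $t\ge 1$ and $k\ge 4$ be integers and $q$ an odd prime power. Set $p=\frac{q^{kt+2}-q^2}{q^k-1}+\frac{q+1}{2}$ and $m=\frac{q^{k(t+1)+2}-q^2}{q^k-1}-\frac{q^2-1}{2}$. Then there is no vector space partition of $\mathbb{F}_q^{k(t+1)+1}$ of type $k^{p-1}\,(k-1)^{m-p+1}\,1^{\frac{q+1}{2}+q^{k-1}}$, i.e., consisting of exactly $p-1$ subspaces of dimension $k$, $m-p+1$ subspaces of dimension $k-1$, and $\frac{q+1}{2}+q^{k-1}$ subspaces of dimension $1$ (and no others).
   Context: A vector space partition of $\mathbb{F}_q^n$ is a collection of nonzero subspaces of $\mathbb{F}_q^n$ such that every nonzero vector of $\mathbb{F}_q^n$ lies in exactly one member of the collection. Its type $k^{m_k}\cdots 1^{m_1}$ records that it contains exactly $m_d$ subspaces of dimension $d$ for each $d$ (factors with $m_d=0$ are omitted). -}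

module Defs where

open import Data.Nat as ℕ using (ℕ; zero; suc; _^_; _∸_; _≤_; _≟_)
open import Data.Nat.DivMod using (_/_)
open import Data.Nat.Primality using (Prime)
open import Data.Fin using (Fin)
open import Data.List using (List; length; filter)
open import Data.Fin.Base using () renaming (zero to fz; suc to fs)
open import Data.List using () renaming (allFin to allFinL)
open import Data.Product using (Σ; ∃; ∃-syntax; _×_; _,_)
open import Data.Product using (∃!)
open import Relation.Binary.PropositionalEquality using (_≡_; _≢_)
open import Relation.Nullary using (¬_)
open import Algebra.Structures using (IsCommutativeRing)
open import Level using (0ℓ)

-- A field whose underlying set is Fin q (so it has exactly q elements),
-- with propositional equality.
record FiniteField (q : ℕ) : Set where
  infixl 6 _+_
  infixl 7 _*_
  field
    _+_ _*_ : Fin q → Fin q → Fin q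
    -_      : Fin q → Fin q
    0# 1#   : Fin q
    isCommutativeRing : IsCommutativeRing _≡_ _+_ _*_ -_ 0# 1#
    0≢1     : 0# ≢ 1#
    inverse : ∀ x → x ≢ 0# → ∃[ y ] (x * y ≡ 1#)

IsPrimePower : ℕ → Set
IsPrimePower q = ∃[ p ] ∃[ r ] (Prime p × 1 ≤ r × q ≡ p ^ r)

Odd : ℕ → Set
Odd q = ∃[ j ] (q ≡ suc (2 ℕ.* j))

-- natural-number division, with the (unused) convention a / 0 = 0
divℕ : ℕ → ℕ → ℕ
divℕ a zero    = 0
divℕ a (suc b) = a / suc b

module VectorSpace {q : ℕ} (F : FiniteField q) where
  open FiniteField F

  Vec : ℕ → Set
  Vec n = Fin n → Fin q

  sumF : (d : ℕ) → (Fin d → Fin q) → Fin q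
  sumF zero    f = 0#
  sumF (suc d) f = f fz + sumF d (λ i → f (fs i))

  lincomb : {n d : ℕ} → (Fin d → Fin q) → (Fin d → Vec n) → Vec n
  lincomb {n} {d} c b j = sumF d (λ i → c i * b i j)

  NonZeroVec : {n : ℕ} → Vec n → Set
  NonZeroVec v = ¬ (∀ j → v j ≡ 0#)

  LinIndep : {n d : ℕ} → (Fin d → Vec n) → Set
  LinIndep {n} {d} b = ∀ (c : Fin d → Fin q) → (∀ j → lincomb c b j ≡ 0#) → ∀ i → c i ≡ 0#

  InSpan : {n d : ℕ} → Vec n → (Fin d → Vec n) → Set
  InSpan {n} {d} v b = ∃[ c ] (∀ j → v j ≡ lincomb c b j)

  -- A vector space partition of F_q^n: a finite family of nonzero subspaces,
  -- each given by a basis (so member i has dimension dim i),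
  -- such that every nonzero vector lies in exactly one member.
  record VSP (n : ℕ) : Set where
    field
      size   : ℕ
      dim    : Fin size → ℕ
      basis  : (i : Fin size) → Fin (dim i) → Vec n
      indep  : ∀ i → LinIndep (basis i)
      dimPos : ∀ i → 1 ≤ dim i
      cover  : ∀ (v : Vec n) → NonZeroVec v → ∃! _≡_ (λ i → InSpan v (basis i))

    mult : ℕ → ℕ
    mult d = length (filter (λ i → dim i ≟ d) (allFinL size))

  open import Data.List using (_∷_; [])
  open import Data.List.Membership.Propositional using (_∈_)

  HasType : {n : ℕ} → VSP n → List (ℕ × ℕ) → Set
  HasType P ty =
    (∀ d m → (d , m) ∈ ty → VSP.mult P d ≡ m) ×
    (∀ d → ¬ (∃[ m ] ((d , m) ∈ ty)) → VSP.mult P d ≡ 0)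

{-# OPTIONS --safe #-}
module Submission where

-- Call the 1-dimensional members of the partition holes, and for a ∈ F_q^n let h(a) be the
-- number of holes in a⊥. Counting the vectors of a⊥ member by member, F_q^n and every member
-- of dimension ≥ k − 1 meet a⊥ in a multiple of q^(k−2) vectors; comparing with a = 0 and
-- cancelling q − 1, a unit modulo q^(k−2), gives h(a) ≡ (q+1)/2 (mod q^(k−2)).
-- If h(a) = (q+1)/2, pick a hole in a⊥ and an e with that hole outside e⊥: counting holes
-- over the q + 1 hyperplanes through a⊥ ∩ e⊥ forces a⊥ ∩ e⊥ to contain at least (q+1)/2
-- holes, although it misses one of the (q+1)/2 holes of a⊥. Hence every hyperplane contains
-- at least (q+1)/2 + q^(k−2) holes, while on average it contains ((q+1)/2 + q^(k−1))/q.
-- Only the number of holes and the lower bound k − 1 on the other dimensions enter.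

open import Defs
open import Algebra.Bundles using (CommutativeRing)
import Algebra.Properties.Ring as RingProperties
import Algebra.Properties.Semiring.Sum as SemiringSum
open import Data.Empty using (⊥; ⊥-elim)
open import Data.Fin.Base using (Fin; zero; suc; fromℕ<)
open import Data.Fin.Properties using (_≟_; all?; ¬∀⟶∃¬; suc-injective; nonZeroIndex)
open import Data.List using (length; filter; tabulate)
open import Data.List.Membership.Propositional using (_∈_)
open import Data.List.Relation.Unary.Any using (here; there)
open import Data.Nat as ℕ using (ℕ; zero; suc; _∸_; _^_; _≤_; _<_; z≤n; s≤s; NonZero; >-nonZero)
open import Data.Nat.DivMod using (_/_; m*n/n≡m)
open import Data.Nat.Divisibility using (_∣_; divides)
open import Data.Product using (Σ; ∃-syntax; _,_; proj₁; proj₂)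
open import Data.Vec.Functional using (Vector; tail)
open import Function.Base using (_∘_)
open import Function.Bundles using (_⇔_; mk⇔; Equivalence)
open import Level using (Level; 0ℓ)
open import Relation.Binary.Bundles using (Setoid)
open import Relation.Binary.Core using (_Preserves_⟶_)
open import Relation.Binary.PropositionalEquality
import Relation.Binary.Reasoning.Setoid as SetoidReasoning
open import Relation.Nullary using (¬_; Dec; yes; no)
open import Relation.Nullary.Decidable using (_×-dec_)

Fin-distinct⇒1<n : ∀ {n} {i j : Fin n} → i ≢ j → 1 < n
Fin-distinct⇒1<n {i = zero}  {zero}  i≢j = ⊥-elim (i≢j refl)
Fin-distinct⇒1<n {i = zero}  {suc j} _   = s≤s (ℕ.>-nonZero⁻¹ _ {{nonZeroIndex j}})
Fin-distinct⇒1<n {i = suc i}         _   = s≤s (ℕ.>-nonZero⁻¹ _ {{nonZeroIndex i}})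

Fin-unique : ∀ {d} → d ≡ 1 → (l l′ : Fin d) → l ≡ l′
Fin-unique refl zero zero = refl

module LinearAlgebra {q : ℕ} (F : FiniteField q) where

  open FiniteField F using (isCommutativeRing; inverse; 0≢1)
  open VectorSpace F

  ring : CommutativeRing 0ℓ 0ℓ
  ring = record { isCommutativeRing = isCommutativeRing }

  open CommutativeRing ring hiding (ring; refl; sym; trans; isEquivalence; setoid; reflexive; zero)
  open RingProperties (CommutativeRing.ring ring) using (-1*x≈-x; [y-z]x≈yx-zx; x∙y⁻¹≈ε⇒x≈y; xyx⁻¹≈y)
  open SemiringSum semiring using (sum; sum-cong-≗; sum-replicate-zero; ∑-distrib-+; ∑-comm; *-distribˡ-sum)

  1<q : 1 < q
  1<q = Fin-distinct⇒1<n 0≢1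

  0ᵥ : ∀ {n} → Vec n
  0ᵥ _ = 0#

  private
    sum-zero : ∀ {n} {f : Vec n} → f ≗ 0ᵥ → sum f ≡ 0#
    sum-zero {n} f≗0 = trans (sum-cong-≗ f≗0) (sum-replicate-zero n)

    sum-neg : ∀ {n} (f : Vec n) → sum (λ i → - f i) ≡ - sum f
    sum-neg f = begin
      sum (λ i → - f i)      ≡⟨ sum-cong-≗ (λ i → -1*x≈-x (f i)) ⟨
      sum (λ i → - 1# * f i) ≡⟨ *-distribˡ-sum (- 1#) f ⟨
      - 1# * sum f           ≡⟨ -1*x≈-x (sum f) ⟩
      - sum f                ∎
      where open ≡-Reasoning

  infix 8 _·_
  _·_ : ∀ {n} → Vec n → Vec n → Fin q
  a · v = sum (λ j → a j * v j)

  ·-comm : ∀ {n} (a v : Vec n) → a · v ≡ v · a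
  ·-comm a v = sum-cong-≗ (λ j → *-comm (a j) (v j))

  ·-congʳ : ∀ {n} (a : Vec n) {v w : Vec n} → v ≗ w → a · v ≡ a · w
  ·-congʳ a v≗w = sum-cong-≗ (λ j → cong (a j *_) (v≗w j))

  ·-zeroʳ : ∀ {n} (a : Vec n) {v : Vec n} → v ≗ 0ᵥ → a · v ≡ 0#
  ·-zeroʳ a v≗0 = sum-zero (λ j → trans (cong (a j *_) (v≗0 j)) (zeroʳ (a j)))

  ·-zeroˡ : ∀ {n} (v : Vec n) → 0ᵥ · v ≡ 0#
  ·-zeroˡ v = sum-zero (λ j → zeroˡ (v j))

  private
    lincomb≡sum : ∀ {n d} (c : Vec d) (b : Fin d → Vec n) j → lincomb c b j ≡ sum (λ i → c i * b i j)
    lincomb≡sum {d = zero}  c b j = refl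
    lincomb≡sum {d = suc d} c b j = cong (c zero * b zero j +_) (lincomb≡sum (c ∘ suc) (b ∘ suc) j)

  ·-lincomb : ∀ {n d} (a : Vec n) (c : Vec d) (b : Fin d → Vec n) → a · lincomb c b ≡ c · (λ i → a · b i)
  ·-lincomb a c b = begin
    sum (λ j → a j * lincomb c b j)
      ≡⟨ sum-cong-≗ (λ j → cong (a j *_) (lincomb≡sum c b j)) ⟩
    sum (λ j → a j * sum (λ i → c i * b i j))
      ≡⟨ sum-cong-≗ (λ j → *-distribˡ-sum (a j) (λ i → c i * b i j)) ⟩
    sum (λ j → sum (λ i → a j * (c i * b i j)))
      ≡⟨ ∑-comm (λ j i → a j * (c i * b i j)) ⟩
    sum (λ i → sum (λ j → a j * (c i * b i j)))
      ≡⟨ sum-cong-≗ (λ i → sum-cong-≗ (λ j → x[yz]≡y[xz] (a j) (c i) (b i j))) ⟩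
    sum (λ i → sum (λ j → c i * (a j * b i j)))
      ≡⟨ sum-cong-≗ (λ i → *-distribˡ-sum (c i) (λ j → a j * b i j)) ⟨
    sum (λ i → c i * (a · b i)) ∎
    where
    open ≡-Reasoning
    x[yz]≡y[xz] : ∀ x y z → x * (y * z) ≡ y * (x * z)
    x[yz]≡y[xz] x y z = trans (sym (*-assoc x y z)) (trans (cong (_* z) (*-comm x y)) (*-assoc y x z))

  lincomb-cong : ∀ {n d} {c c′ : Vec d} (b : Fin d → Vec n) → c ≗ c′ → lincomb c b ≗ lincomb c′ b
  lincomb-cong {c = c} {c′} b c≗c′ j = begin
    lincomb c b j             ≡⟨ lincomb≡sum c b j ⟩
    sum (λ i → c i * b i j)   ≡⟨ sum-cong-≗ (λ i → cong (_* b i j) (c≗c′ i)) ⟩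
    sum (λ i → c′ i * b i j)  ≡⟨ lincomb≡sum c′ b j ⟨
    lincomb c′ b j            ∎
    where open ≡-Reasoning

  lincomb-zero : ∀ {n d} (b : Fin d → Vec n) → lincomb 0ᵥ b ≗ 0ᵥ
  lincomb-zero b j = trans (lincomb≡sum 0ᵥ b j) (sum-zero (λ i → zeroˡ (b i j)))

  private
    lincomb-sub : ∀ {n d} (c c′ : Vec d) (b : Fin d → Vec n) j →
                  lincomb (λ i → c i - c′ i) b j ≡ lincomb c b j - lincomb c′ b j
    lincomb-sub c c′ b j = begin
      lincomb (λ i → c i - c′ i) b j
        ≡⟨ lincomb≡sum _ b j ⟩
      sum (λ i → (c i - c′ i) * b i j)
        ≡⟨ sum-cong-≗ (λ i → [y-z]x≈yx-zx (b i j) (c i) (c′ i)) ⟩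
      sum (λ i → c i * b i j - c′ i * b i j)
        ≡⟨ ∑-distrib-+ (λ i → c i * b i j) (λ i → - (c′ i * b i j)) ⟩
      sum (λ i → c i * b i j) + sum (λ i → - (c′ i * b i j))
        ≡⟨ cong (sum (λ i → c i * b i j) +_) (sum-neg (λ i → c′ i * b i j)) ⟩
      sum (λ i → c i * b i j) - sum (λ i → c′ i * b i j)
        ≡⟨ cong₂ _-_ (lincomb≡sum c b j) (lincomb≡sum c′ b j) ⟨
      lincomb c b j - lincomb c′ b j ∎
      where open ≡-Reasoning

  lincomb-injective : ∀ {n d} {b : Fin d → Vec n} → LinIndep b →
                      ∀ c c′ → (∀ j → lincomb c b j ≡ lincomb c′ b j) → c ≗ c′
  lincomb-injective {b = b} indep c c′ eq i = x∙y⁻¹≈ε⇒x≈y (c i) (c′ i) (indep (λ i → c i - c′ i) c-c′↦0 i)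
    where
    c-c′↦0 : ∀ j → lincomb (λ i → c i - c′ i) b j ≡ 0#
    c-c′↦0 j = trans (lincomb-sub c c′ b j) (trans (cong (_- lincomb c′ b j) (eq j)) (-‿inverseʳ _))

  unit : ∀ {n} → Fin n → Vec n
  unit zero    zero    = 1#
  unit zero    (suc j) = 0#
  unit (suc i) zero    = 0#
  unit (suc i) (suc j) = unit i j

  unit-· : ∀ {n} (i : Fin n) (v : Vec n) → unit i · v ≡ v i
  unit-· zero    v = trans (cong₂ _+_ (*-identityˡ (v zero)) (sum-zero (λ j → zeroˡ (v (suc j))))) (+-identityʳ _)
  unit-· (suc i) v = trans (cong₂ _+_ (zeroˡ (v zero)) (unit-· i (v ∘ suc))) (+-identityˡ _)

  private
    unit-self : ∀ {n} (i : Fin n) → unit i i ≡ 1#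
    unit-self zero    = refl
    unit-self (suc i) = unit-self i

  LinIndep⇒nonzero : ∀ {n d} {b : Fin d → Vec n} → LinIndep b → ∀ i → ¬ b i ≗ 0ᵥ
  LinIndep⇒nonzero {b = b} indep i bi≗0 = 0≢1 (trans (sym (indep (unit i) unit↦0 i)) (unit-self i))
    where
    unit↦0 : ∀ j → lincomb (unit i) b j ≡ 0#
    unit↦0 j = trans (lincomb≡sum (unit i) b j) (trans (unit-· i (λ l → b l j)) (bi≗0 j))

  pencil : ∀ {n} → Vec n → Vec n → Fin q → Vec n
  pencil e a x j = e j + x * a j

  pencil-· : ∀ {n} (e a u : Vec n) x → pencil e a x · u ≡ e · u + x * (a · u)
  pencil-· e a u x = begin
    sum (λ j → (e j + x * a j) * u j)
      ≡⟨ sum-cong-≗ (λ j → trans (distribʳ (u j) (e j) (x * a j)) (cong (e j * u j +_) (*-assoc x (a j) (u j)))) ⟩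
    sum (λ j → e j * u j + x * (a j * u j))
      ≡⟨ ∑-distrib-+ (λ j → e j * u j) (λ j → x * (a j * u j)) ⟩
    e · u + sum (λ j → x * (a j * u j))
      ≡⟨ cong (e · u +_) (*-distribˡ-sum x (λ j → a j * u j)) ⟨
    e · u + x * (a · u) ∎
    where open ≡-Reasoning

  affine-solution : ∀ {y} → y ≢ 0# → ∀ z r → ∃[ x₀ ] (∀ x → (z + x * y ≡ r) ⇔ (x ≡ x₀))
  affine-solution {y} y≢0 z r = (r - z) * y⁻¹ , λ x → mk⇔ (solution x) (λ { refl → solves })
    where
    y⁻¹ = proj₁ (inverse y y≢0)
    yy⁻¹≡1 : y * y⁻¹ ≡ 1#
    yy⁻¹≡1 = proj₂ (inverse y y≢0)
    open ≡-Reasoning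
    solution : ∀ x → z + x * y ≡ r → x ≡ (r - z) * y⁻¹
    solution x eq = begin
      x                     ≡⟨ *-identityʳ x ⟨
      x * 1#                ≡⟨ cong (x *_) yy⁻¹≡1 ⟨
      x * (y * y⁻¹)         ≡⟨ *-assoc x y y⁻¹ ⟨
      x * y * y⁻¹           ≡⟨ cong (_* y⁻¹) (xyx⁻¹≈y z (x * y)) ⟨
      (z + x * y - z) * y⁻¹ ≡⟨ cong (λ t → (t - z) * y⁻¹) eq ⟩
      (r - z) * y⁻¹         ∎
    solves : z + (r - z) * y⁻¹ * y ≡ r
    solves = begin
      z + (r - z) * y⁻¹ * y   ≡⟨ cong (z +_) (*-assoc _ y⁻¹ y) ⟩
      z + (r - z) * (y⁻¹ * y) ≡⟨ cong (λ t → z + (r - z) * t) (trans (*-comm y⁻¹ y) yy⁻¹≡1) ⟩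
      z + (r - z) * 1#        ≡⟨ cong (z +_) (*-identityʳ _) ⟩
      z + (r - z)             ≡⟨ +-assoc z r (- z) ⟨
      z + r - z               ≡⟨ xyx⁻¹≈y z r ⟩
      r                       ∎

-- Opened only here: the field operations and ring laws of LinearAlgebra carry the same names.
open import Data.Nat using (_+_; _*_)
open import Data.Nat.Properties hiding (_≟_; suc-injective)
open import Data.Nat.Tactic.RingSolver using (solve-∀)

open SemiringSum +-*-semiring using (sum; sum-syntax; sum-cong-≗; ∑-distrib-+; ∑-comm; *-distribˡ-sum; *-distribʳ-sum)

private
  variable
    ℓ ℓ′ : Level
    P : Set ℓ
    Q : Set ℓ′

𝟙 : Dec P → ℕ
𝟙 (yes _) = 1
𝟙 (no _)  = 0

𝟙-yes : (P? : Dec P) → P → 𝟙 P? ≡ 1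
𝟙-yes (yes _) _  = refl
𝟙-yes (no ¬p) p′ = ⊥-elim (¬p p′)

𝟙-no : (P? : Dec P) → ¬ P → 𝟙 P? ≡ 0
𝟙-no (yes p′) ¬p = ⊥-elim (¬p p′)
𝟙-no (no _)   _  = refl

𝟙≤1 : (P? : Dec P) → 𝟙 P? ≤ 1
𝟙≤1 (yes _) = s≤s z≤n
𝟙≤1 (no _)  = z≤n

m*𝟙≤m : ∀ m (P? : Dec P) → m * 𝟙 P? ≤ m
m*𝟙≤m m P? = ≤-trans (*-monoʳ-≤ m (𝟙≤1 P?)) (≤-reflexive (*-identityʳ m))

𝟙-cong : (P? : Dec P) (Q? : Dec Q) → (P → Q) → (Q → P) → 𝟙 P? ≡ 𝟙 Q?
𝟙-cong (yes p′) Q? f g = sym (𝟙-yes Q? (f p′))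
𝟙-cong (no ¬p)  Q? f g = sym (𝟙-no Q? (¬p ∘ g))

𝟙-×-dec : (P? : Dec P) (Q? : Dec Q) → 𝟙 (P? ×-dec Q?) ≡ 𝟙 P? * 𝟙 Q?
𝟙-×-dec (yes _) (yes _) = refl
𝟙-×-dec (yes _) (no _)  = refl
𝟙-×-dec (no _)  _       = refl

sum-const : ∀ n k → ∑[ i < n ] k ≡ n * k
sum-const zero    k = refl
sum-const (suc n) k = cong (k +_) (sum-const n k)

sum-zero : ∀ n {f : Fin n → ℕ} → (∀ i → f i ≡ 0) → sum f ≡ 0
sum-zero n {f} f≡0 = trans (sum-cong-≗ f≡0) (trans (sum-const n 0) (*-zeroʳ n))

sum-mono-≤ : ∀ {n} {f g : Fin n → ℕ} → (∀ i → f i ≤ g i) → sum f ≤ sum g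
sum-mono-≤ {zero}  f≤g = z≤n
sum-mono-≤ {suc n} f≤g = +-mono-≤ (f≤g zero) (sum-mono-≤ (f≤g ∘ suc))

sum-mono-< : ∀ {n} {f g : Fin n → ℕ} → (∀ i → f i ≤ g i) → ∀ i → f i < g i → sum f < sum g
sum-mono-< f≤g zero    fi<gi = +-mono-<-≤ fi<gi (sum-mono-≤ (f≤g ∘ suc))
sum-mono-< f≤g (suc i) fi<gi = +-mono-≤-< (f≤g zero) (sum-mono-< (f≤g ∘ suc) i fi<gi)

≤-sum : ∀ {n} (f : Fin n → ℕ) i → f i ≤ sum f
≤-sum f zero    = m≤m+n (f zero) _
≤-sum f (suc i) = ≤-trans (≤-sum (f ∘ suc) i) (m≤n+m _ (f zero))

sum>0⇒ : ∀ {n} (f : Fin n → ℕ) → 0 < sum f → ∃[ i ] 0 < f i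
sum>0⇒ {suc n} f 0<Σ with f zero ℕ.≟ 0
... | no  f₀≢0 = zero , n≢0⇒n>0 f₀≢0
... | yes f₀≡0 with sum>0⇒ (f ∘ suc) (subst (0 <_) (cong (_+ sum (f ∘ suc)) f₀≡0) 0<Σ)
...   | i , 0<fi = suc i , 0<fi

sum-delta : ∀ {n} (i₀ : Fin n) (f : Fin n → ℕ) → ∑[ i < n ] (𝟙 (i ≟ i₀) * f i) ≡ f i₀
sum-delta {suc n} zero f = begin
  1 * f zero + ∑[ i < n ] (𝟙 (suc i ≟ zero) * f (suc i)) ≡⟨ cong (1 * f zero +_) (sum-zero n (λ _ → refl)) ⟩
  1 * f zero + 0                                       ≡⟨ +-identityʳ _ ⟩
  1 * f zero                                           ≡⟨ *-identityˡ _ ⟩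
  f zero                                               ∎
  where open ≡-Reasoning
sum-delta {suc n} (suc i₀) f = begin
  0 * f zero + ∑[ i < n ] (𝟙 (suc i ≟ suc i₀) * f (suc i)) ≡⟨ sum-cong-≗ 𝟙-suc ⟩
  ∑[ i < n ] (𝟙 (i ≟ i₀) * f (suc i))                       ≡⟨ sum-delta i₀ (f ∘ suc) ⟩
  f (suc i₀)                                                ∎
  where
  open ≡-Reasoning
  𝟙-suc : ∀ i → 𝟙 (suc i ≟ suc i₀) * f (suc i) ≡ 𝟙 (i ≟ i₀) * f (suc i)
  𝟙-suc i = cong (_* f (suc i)) (𝟙-cong (suc i ≟ suc i₀) (i ≟ i₀) suc-injective (cong suc))

sum-𝟙-≟ : ∀ {n} (i₀ : Fin n) → ∑[ i < n ] 𝟙 (i ≟ i₀) ≡ 1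
sum-𝟙-≟ i₀ = trans (sum-cong-≗ (λ i → sym (*-identityʳ (𝟙 (i ≟ i₀))))) (sum-delta i₀ (λ _ → 1))

length-filter-tabulate : ∀ {a} {A : Set a} {P : A → Set ℓ} (P? : ∀ x → Dec (P x)) {n} (f : Fin n → A) →
                         length (filter P? (tabulate f)) ≡ ∑[ i < n ] 𝟙 (P? (f i))
length-filter-tabulate P? {zero}  f = refl
length-filter-tabulate P? {suc n} f with P? (f zero)
... | yes _ = cong suc (length-filter-tabulate P? (f ∘ suc))
... | no  _ = length-filter-tabulate P? (f ∘ suc)

infix 4 _≡_mod_
record _≡_mod_ (a b d : ℕ) : Set where
  constructor congruence
  field
    x y : ℕ
    a+x*d≡b+y*d : a + x * d ≡ b + y * d

module _ {d : ℕ} where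

  ≡⇒≡-mod : ∀ {a b} → a ≡ b → a ≡ b mod d
  ≡⇒≡-mod refl = congruence 0 0 refl

  ≡-mod-sym : ∀ {a b} → a ≡ b mod d → b ≡ a mod d
  ≡-mod-sym (congruence x y eq) = congruence y x (sym eq)

  ≡-mod-trans : ∀ {a b c} → a ≡ b mod d → b ≡ c mod d → a ≡ c mod d
  ≡-mod-trans {a} {b} {c} (congruence x y a≡b) (congruence x′ y′ b≡c) = congruence (x + x′) (y′ + y) (begin
    a + (x + x′) * d      ≡⟨ regroup a x x′ d ⟩
    (a + x * d) + x′ * d  ≡⟨ cong (_+ x′ * d) a≡b ⟩
    (b + y * d) + x′ * d  ≡⟨ swap b y x′ d ⟩
    (b + x′ * d) + y * d  ≡⟨ cong (_+ y * d) b≡c ⟩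
    (c + y′ * d) + y * d  ≡⟨ regroup c y′ y d ⟨
    c + (y′ + y) * d      ∎)
    where
    open ≡-Reasoning
    regroup : ∀ a x x′ d → a + (x + x′) * d ≡ (a + x * d) + x′ * d
    regroup = solve-∀
    swap : ∀ b y x′ d → (b + y * d) + x′ * d ≡ (b + x′ * d) + y * d
    swap = solve-∀

  +-cong-mod : ∀ {a b c e} → a ≡ b mod d → c ≡ e mod d → a + c ≡ b + e mod d
  +-cong-mod {a} {b} {c} {e} (congruence x y a≡b) (congruence x′ y′ c≡e) = congruence (x + x′) (y + y′) (begin
    a + c + (x + x′) * d        ≡⟨ interchange a c x x′ d ⟩
    (a + x * d) + (c + x′ * d)  ≡⟨ cong₂ _+_ a≡b c≡e ⟩
    (b + y * d) + (e + y′ * d)  ≡⟨ interchange b e y y′ d ⟨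
    b + e + (y + y′) * d        ∎)
    where
    open ≡-Reasoning
    interchange : ∀ a c x x′ d → a + c + (x + x′) * d ≡ (a + x * d) + (c + x′ * d)
    interchange = solve-∀

  +-cancelˡ-mod : ∀ k {a b} → k + a ≡ k + b mod d → a ≡ b mod d
  +-cancelˡ-mod k {a} {b} (congruence x y eq) =
    congruence x y (+-cancelˡ-≡ k _ _ (trans (sym (+-assoc k a (x * d))) (trans eq (+-assoc k b (y * d)))))

  *-cancelˡ-mod : ∀ k .{{_ : NonZero k}} {a b} → k * a ≡ k * b mod (k * d) → a ≡ b mod d
  *-cancelˡ-mod k {a} {b} (congruence x y eq) = congruence x y (*-cancelˡ-≡ (a + x * d) (b + y * d) k (begin
    k * (a + x * d)       ≡⟨ factor k a x d ⟩
    k * a + x * (k * d)   ≡⟨ eq ⟩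
    k * b + y * (k * d)   ≡⟨ factor k b y d ⟨
    k * (b + y * d)       ∎))
    where
    open ≡-Reasoning
    factor : ∀ k a x d → k * (a + x * d) ≡ k * a + x * (k * d)
    factor = solve-∀

  +-multiple-mod : ∀ a k → a + k * d ≡ a mod d
  +-multiple-mod a k = congruence 0 k (+-identityʳ (a + k * d))

  ∣⇒≡0-mod : ∀ {a} → d ∣ a → a ≡ 0 mod d
  ∣⇒≡0-mod (divides k refl) = congruence 0 k (+-identityʳ (k * d))

  sum-cong-mod : ∀ {m} {f g : Fin m → ℕ} → (∀ i → f i ≡ g i mod d) → sum f ≡ sum g mod d
  sum-cong-mod {zero}  f≡g = ≡⇒≡-mod refl
  sum-cong-mod {suc m} f≡g = +-cong-mod (f≡g zero) (sum-cong-mod (f≡g ∘ suc))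

  ≡-mod⇒≡+multiple : ∀ {a r} → a ≡ r mod d → r < d → ∃[ j ] a ≡ r + j * d
  ≡-mod⇒≡+multiple {a} {r} (congruence x y eq) r<d with x ≤? y
  ... | yes x≤y = let (j , x+j≡y) = m≤n⇒∃[o]m+o≡n x≤y in
    j , +-cancelʳ-≡ (x * d) a (r + j * d) (begin
      a + x * d           ≡⟨ eq ⟩
      r + y * d           ≡⟨ cong (λ t → r + t * d) x+j≡y ⟨
      r + (x + j) * d     ≡⟨ shift r x j d ⟩
      r + j * d + x * d   ∎)
    where
    open ≡-Reasoning
    shift : ∀ r x j d → r + (x + j) * d ≡ r + j * d + x * d
    shift = solve-∀
  ... | no x≰y = let (j , 1+y+j≡x) = m≤n⇒∃[o]m+o≡n (≰⇒> x≰y) in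
    ⊥-elim (<⇒≱ r<d (begin
      d                     ≤⟨ m≤m+n d (j * d) ⟩
      suc j * d             ≤⟨ m≤n+m (suc j * d) a ⟩
      a + suc j * d         ≡⟨ +-cancelʳ-≡ (y * d) _ _ (begin-equality
        a + suc j * d + y * d ≡⟨ shift a y j d ⟩
        a + (suc y + j) * d   ≡⟨ cong (λ t → a + t * d) 1+y+j≡x ⟩
        a + x * d             ≡⟨ eq ⟩
        r + y * d             ∎) ⟩
      r                     ∎))
    where
    open ≤-Reasoning
    shift : ∀ a y j d → a + suc j * d + y * d ≡ a + (suc y + j) * d
    shift = solve-∀

≡-mod-setoid : ℕ → Setoid 0ℓ 0ℓ
≡-mod-setoid d = record
  { Carrier       = ℕ
  ; _≈_           = λ a b → a ≡ b mod d
  ; isEquivalence = record { refl = ≡⇒≡-mod refl ; sym = ≡-mod-sym ; trans = ≡-mod-trans }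
  }

module ≡-mod-Reasoning (d : ℕ) = SetoidReasoning (≡-mod-setoid d)

-- θ is an inverse of −u modulo d.
unit-cancel-mod : ∀ u θ {d a b} → 1 + u * θ ≡ d → u * a ≡ u * b mod d → a ≡ b mod d
unit-cancel-mod u θ {a = a} {b} refl (congruence x y eq) = congruence (b + θ * y) (a + θ * x) (begin
  a + (b + θ * y) * (1 + u * θ)         ≡⟨ expand a b u θ y ⟩
  a + b + θ * (u * b + y * (1 + u * θ)) ≡⟨ cong (λ t → a + b + θ * t) eq ⟨
  a + b + θ * (u * a + x * (1 + u * θ)) ≡⟨ expand′ a b u θ x ⟩
  b + (a + θ * x) * (1 + u * θ)         ∎)
  where
  open ≡-Reasoning
  expand : ∀ a b u θ y → a + (b + θ * y) * (1 + u * θ) ≡ a + b + θ * (u * b + y * (1 + u * θ))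
  expand = solve-∀
  expand′ : ∀ a b u θ x → a + b + θ * (u * a + x * (1 + u * θ)) ≡ b + (a + θ * x) * (1 + u * θ)
  expand′ = solve-∀

[1+q₁]^m≡1+q₁*θ : ∀ q₁ m → ∃[ θ ] 1 + q₁ * θ ≡ suc q₁ ^ m
[1+q₁]^m≡1+q₁*θ q₁ zero    = 0 , cong suc (*-zeroʳ q₁)
[1+q₁]^m≡1+q₁*θ q₁ (suc m) = let (θ , eq) = [1+q₁]^m≡1+q₁*θ q₁ m in
  suc θ + q₁ * θ , trans (step q₁ θ) (cong (suc q₁ *_) eq)
  where
  step : ∀ q₁ θ → 1 + q₁ * (suc θ + q₁ * θ) ≡ suc q₁ * (1 + q₁ * θ)
  step = solve-∀

module VectorSums (q : ℕ) where

  open import Data.Vec.Functional using ([]; _∷_)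

  ∑ᵥ : ∀ d → (Vector (Fin q) d → ℕ) → ℕ
  ∑ᵥ zero    f = f []
  ∑ᵥ (suc d) f = ∑[ x < q ] ∑ᵥ d (λ c → f (x ∷ c))

  ∑ᵥ-cong : ∀ d {f g : Vector (Fin q) d → ℕ} → (∀ c → f c ≡ g c) → ∑ᵥ d f ≡ ∑ᵥ d g
  ∑ᵥ-cong zero    f≡g = f≡g []
  ∑ᵥ-cong (suc d) f≡g = sum-cong-≗ (λ x → ∑ᵥ-cong d (λ c → f≡g (x ∷ c)))

  ∑ᵥ-distrib-+ : ∀ d (f g : Vector (Fin q) d → ℕ) → ∑ᵥ d (λ c → f c + g c) ≡ ∑ᵥ d f + ∑ᵥ d g
  ∑ᵥ-distrib-+ zero    f g = refl
  ∑ᵥ-distrib-+ (suc d) f g =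
    trans (sum-cong-≗ (λ x → ∑ᵥ-distrib-+ d (λ c → f (x ∷ c)) (λ c → g (x ∷ c))))
          (∑-distrib-+ (λ x → ∑ᵥ d (λ c → f (x ∷ c))) (λ x → ∑ᵥ d (λ c → g (x ∷ c))))

  *-distribˡ-∑ᵥ : ∀ d k (f : Vector (Fin q) d → ℕ) → k * ∑ᵥ d f ≡ ∑ᵥ d (λ c → k * f c)
  *-distribˡ-∑ᵥ zero    k f = refl
  *-distribˡ-∑ᵥ (suc d) k f =
    trans (*-distribˡ-sum k (λ x → ∑ᵥ d (λ c → f (x ∷ c))))
          (sum-cong-≗ (λ x → *-distribˡ-∑ᵥ d k (λ c → f (x ∷ c))))

  *-distribʳ-∑ᵥ : ∀ d k (f : Vector (Fin q) d → ℕ) → ∑ᵥ d f * k ≡ ∑ᵥ d (λ c → f c * k)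
  *-distribʳ-∑ᵥ d k f =
    trans (*-comm (∑ᵥ d f) k) (trans (*-distribˡ-∑ᵥ d k f) (∑ᵥ-cong d (λ c → *-comm k (f c))))

  ∑ᵥ-const : ∀ d k → ∑ᵥ d (λ _ → k) ≡ q ^ d * k
  ∑ᵥ-const zero    k = sym (+-identityʳ k)
  ∑ᵥ-const (suc d) k = begin
    ∑[ x < q ] ∑ᵥ d (λ _ → k) ≡⟨ sum-cong-≗ {q} (λ _ → ∑ᵥ-const d k) ⟩
    ∑[ x < q ] (q ^ d * k)    ≡⟨ sum-const q _ ⟩
    q * (q ^ d * k)           ≡⟨ *-assoc q (q ^ d) k ⟨
    q ^ suc d * k             ∎
    where open ≡-Reasoning

  ∑ᵥ-zero : ∀ d {f : Vector (Fin q) d → ℕ} → (∀ c → f c ≡ 0) → ∑ᵥ d f ≡ 0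
  ∑ᵥ-zero d f≡0 = trans (∑ᵥ-cong d f≡0) (trans (∑ᵥ-const d 0) (*-zeroʳ (q ^ d)))

  ∑ᵥ-mono-≤ : ∀ d {f g : Vector (Fin q) d → ℕ} → (∀ c → f c ≤ g c) → ∑ᵥ d f ≤ ∑ᵥ d g
  ∑ᵥ-mono-≤ zero    f≤g = f≤g []
  ∑ᵥ-mono-≤ (suc d) f≤g = sum-mono-≤ (λ x → ∑ᵥ-mono-≤ d (λ c → f≤g (x ∷ c)))

  ∑ᵥ-comm-∑ : ∀ d {m} (f : Vector (Fin q) d → Fin m → ℕ) →
              ∑ᵥ d (λ c → ∑[ i < m ] f c i) ≡ ∑[ i < m ] ∑ᵥ d (λ c → f c i)
  ∑ᵥ-comm-∑ zero    f = refl
  ∑ᵥ-comm-∑ (suc d) f =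
    trans (sum-cong-≗ (λ x → ∑ᵥ-comm-∑ d (λ c → f (x ∷ c))))
          (∑-comm (λ x i → ∑ᵥ d (λ c → f (x ∷ c) i)))

  ∑ᵥ-comm : ∀ d e (f : Vector (Fin q) d → Vector (Fin q) e → ℕ) →
            ∑ᵥ d (λ c → ∑ᵥ e (f c)) ≡ ∑ᵥ e (λ c′ → ∑ᵥ d (λ c → f c c′))
  ∑ᵥ-comm d zero    f = refl
  ∑ᵥ-comm d (suc e) f =
    trans (∑ᵥ-comm-∑ d (λ c x → ∑ᵥ e (λ c′ → f c (x ∷ c′))))
          (sum-cong-≗ (λ x → ∑ᵥ-comm d e (λ c c′ → f c (x ∷ c′))))

  infix 4 _≟ᵥ_
  _≟ᵥ_ : ∀ {d} (c c′ : Vector (Fin q) d) → Dec (c ≗ c′)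
  c ≟ᵥ c′ = all? (λ i → c i ≟ c′ i)

  ∑ᵥ-delta : ∀ d (c₀ : Vector (Fin q) d) (f : Vector (Fin q) d → ℕ) → f Preserves _≗_ ⟶ _≡_ →
             ∑ᵥ d (λ c → 𝟙 (c ≟ᵥ c₀) * f c) ≡ f c₀
  ∑ᵥ-delta zero    c₀ f f-cong = trans (+-identityʳ (f [])) (f-cong (λ ()))
  ∑ᵥ-delta (suc d) c₀ f f-cong = begin
    ∑[ x < q ] ∑ᵥ d (λ c → 𝟙 (x ∷ c ≟ᵥ c₀) * f (x ∷ c))
      ≡⟨ sum-cong-≗ (λ x → ∑ᵥ-cong d (λ c → split x c)) ⟩
    ∑[ x < q ] ∑ᵥ d (λ c → 𝟙 (x ≟ c₀ zero) * (𝟙 (c ≟ᵥ tail c₀) * f (x ∷ c)))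
      ≡⟨ sum-cong-≗ (λ x → *-distribˡ-∑ᵥ d (𝟙 (x ≟ c₀ zero)) _) ⟨
    ∑[ x < q ] (𝟙 (x ≟ c₀ zero) * ∑ᵥ d (λ c → 𝟙 (c ≟ᵥ tail c₀) * f (x ∷ c)))
      ≡⟨ sum-cong-≗ (λ x → cong (𝟙 (x ≟ c₀ zero) *_)
                                (∑ᵥ-delta d (tail c₀) (f ∘ (x ∷_)) (f-cong ∘ ∷-cong))) ⟩
    ∑[ x < q ] (𝟙 (x ≟ c₀ zero) * f (x ∷ tail c₀))
      ≡⟨ sum-delta (c₀ zero) (λ x → f (x ∷ tail c₀)) ⟩
    f (c₀ zero ∷ tail c₀)
      ≡⟨ f-cong (λ { zero → refl ; (suc i) → refl }) ⟩
    f c₀ ∎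
    where
    open ≡-Reasoning
    ∷-cong : ∀ {x} {c c′ : Vector (Fin q) d} → c ≗ c′ → x ∷ c ≗ x ∷ c′
    ∷-cong c≗c′ zero    = refl
    ∷-cong c≗c′ (suc i) = c≗c′ i
    split : ∀ x c → 𝟙 (x ∷ c ≟ᵥ c₀) * f (x ∷ c) ≡ 𝟙 (x ≟ c₀ zero) * (𝟙 (c ≟ᵥ tail c₀) * f (x ∷ c))
    split x c = begin
      𝟙 (x ∷ c ≟ᵥ c₀) * f (x ∷ c)
        ≡⟨ cong (_* f (x ∷ c)) (𝟙-cong (x ∷ c ≟ᵥ c₀) ((x ≟ c₀ zero) ×-dec (c ≟ᵥ tail c₀))
             (λ eq → eq zero , eq ∘ suc) (λ { (eq₀ , eq) zero → eq₀ ; (eq₀ , eq) (suc i) → eq i })) ⟩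
      𝟙 ((x ≟ c₀ zero) ×-dec (c ≟ᵥ tail c₀)) * f (x ∷ c)
        ≡⟨ cong (_* f (x ∷ c)) (𝟙-×-dec (x ≟ c₀ zero) (c ≟ᵥ tail c₀)) ⟩
      𝟙 (x ≟ c₀ zero) * 𝟙 (c ≟ᵥ tail c₀) * f (x ∷ c)
        ≡⟨ *-assoc (𝟙 (x ≟ c₀ zero)) _ _ ⟩
      𝟙 (x ≟ c₀ zero) * (𝟙 (c ≟ᵥ tail c₀) * f (x ∷ c)) ∎

  ∑ᵥ-𝟙-≟ᵥ : ∀ {d} (c₀ : Vector (Fin q) d) → ∑ᵥ d (λ c → 𝟙 (c ≟ᵥ c₀)) ≡ 1
  ∑ᵥ-𝟙-≟ᵥ {d} c₀ =
    trans (∑ᵥ-cong d (λ c → sym (*-identityʳ (𝟙 (c ≟ᵥ c₀))))) (∑ᵥ-delta d c₀ (λ _ → 1) (λ _ → refl))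

module Counting {q : ℕ} (F : FiniteField q) where

  open VectorSpace F using (Vec)
  open LinearAlgebra F
  open VectorSums q
  module 𝔽 = CommutativeRing ring
  open 𝔽 public using (0#)

  instance
    q-nonZero : NonZero q
    q-nonZero = nonZeroIndex 0#

  affine-count : ∀ {y} → y ≢ 0# → ∀ z r → ∑[ x < q ] 𝟙 (z 𝔽.+ x 𝔽.* y ≟ r) ≡ 1
  affine-count {y} y≢0 z r with affine-solution y≢0 z r
  ... | x₀ , solves⇔ = trans (sum-cong-≗ 𝟙-solves≡𝟙-≟) (sum-𝟙-≟ x₀)
    where
    𝟙-solves≡𝟙-≟ : ∀ x → 𝟙 (z 𝔽.+ x 𝔽.* y ≟ r) ≡ 𝟙 (x ≟ x₀)
    𝟙-solves≡𝟙-≟ x =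
      𝟙-cong (z 𝔽.+ x 𝔽.* y ≟ r) (x ≟ x₀) (Equivalence.to (solves⇔ x)) (Equivalence.from (solves⇔ x))

  #solutions : ∀ d → Vec d → Fin q → Fin q → ℕ
  #solutions d w y r = ∑ᵥ d (λ c → 𝟙 (y 𝔽.+ c · w ≟ r))

  #solutions-zero : ∀ d {w : Vec d} → w ≗ 0ᵥ → ∀ y r → #solutions d w y r ≡ q ^ d * 𝟙 (y ≟ r)
  #solutions-zero d {w} w≗0 y r = trans (∑ᵥ-cong d y+c·w≡y) (∑ᵥ-const d (𝟙 (y ≟ r)))
    where
    y+c·w≡y : ∀ c → 𝟙 (y 𝔽.+ c · w ≟ r) ≡ 𝟙 (y ≟ r)
    y+c·w≡y c = cong (λ t → 𝟙 (t ≟ r)) (trans (cong (y 𝔽.+_) (·-zeroʳ c w≗0)) (𝔽.+-identityʳ y))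

  #solutions-suc : ∀ d (w : Vec (suc d)) y r →
                   #solutions (suc d) w y r ≡ ∑[ x < q ] #solutions d (tail w) (y 𝔽.+ x 𝔽.* w zero) r
  #solutions-suc d w y r = sum-cong-≗ (λ x → ∑ᵥ-cong d (λ c →
    cong (λ t → 𝟙 (t ≟ r)) (sym (𝔽.+-assoc y (x 𝔽.* w zero) (c · tail w)))))

  #solutions-nonzero : ∀ d {w : Vec d} → ¬ w ≗ 0ᵥ → ∀ y r → q * #solutions d w y r ≡ q ^ d
  #solutions-nonzero zero    w≉0 y r = ⊥-elim (w≉0 (λ ()))
  #solutions-nonzero (suc d) {w} w≉0 y r with tail w ≟ᵥ 0ᵥ
  ... | no w′≉0 = begin
    q * #solutions (suc d) w y r
      ≡⟨ cong (q *_) (#solutions-suc d w y r) ⟩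
    q * ∑[ x < q ] #solutions d (tail w) (y 𝔽.+ x 𝔽.* w zero) r
      ≡⟨ *-distribˡ-sum q (λ x → #solutions d (tail w) (y 𝔽.+ x 𝔽.* w zero) r) ⟩
    ∑[ x < q ] (q * #solutions d (tail w) (y 𝔽.+ x 𝔽.* w zero) r)
      ≡⟨ sum-cong-≗ (λ x → #solutions-nonzero d w′≉0 (y 𝔽.+ x 𝔽.* w zero) r) ⟩
    ∑[ x < q ] (q ^ d)
      ≡⟨ sum-const q (q ^ d) ⟩
    q ^ suc d ∎
    where open ≡-Reasoning
  ... | yes w′≗0 = begin
    q * #solutions (suc d) w y r
      ≡⟨ cong (q *_) (#solutions-suc d w y r) ⟩
    q * ∑[ x < q ] #solutions d (tail w) (y 𝔽.+ x 𝔽.* w zero) r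
      ≡⟨ cong (q *_) (sum-cong-≗ (λ x → #solutions-zero d w′≗0 (y 𝔽.+ x 𝔽.* w zero) r)) ⟩
    q * ∑[ x < q ] (q ^ d * 𝟙 (y 𝔽.+ x 𝔽.* w zero ≟ r))
      ≡⟨ cong (q *_) (*-distribˡ-sum (q ^ d) (λ x → 𝟙 (y 𝔽.+ x 𝔽.* w zero ≟ r))) ⟨
    q * (q ^ d * ∑[ x < q ] 𝟙 (y 𝔽.+ x 𝔽.* w zero ≟ r))
      ≡⟨ cong (λ t → q * (q ^ d * t)) (affine-count w₀≢0 y r) ⟩
    q * (q ^ d * 1)
      ≡⟨ cong (q *_) (*-identityʳ (q ^ d)) ⟩
    q ^ suc d ∎
    where
    open ≡-Reasoning
    w₀≢0 : w zero ≢ 0#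
    w₀≢0 w₀≡0 = w≉0 (λ { zero → w₀≡0 ; (suc j) → w′≗0 j })

  #ker : ∀ {d} → Vec d → ℕ
  #ker {d} w = ∑ᵥ d (λ c → 𝟙 (c · w ≟ 0#))

  #ker≡#solutions : ∀ d (w : Vec d) → #ker w ≡ #solutions d w 0# 0#
  #ker≡#solutions d w = ∑ᵥ-cong d (λ c → cong (λ t → 𝟙 (t ≟ 0#)) (sym (𝔽.+-identityˡ (c · w))))

  #ker-zero : ∀ d {w : Vec d} → w ≗ 0ᵥ → #ker w ≡ q ^ d
  #ker-zero d {w} w≗0 = begin
    #ker w                    ≡⟨ #ker≡#solutions d w ⟩
    #solutions d w 0# 0#  ≡⟨ #solutions-zero d w≗0 0# 0# ⟩
    q ^ d * 𝟙 (0# ≟ 0#)   ≡⟨ cong (q ^ d *_) (𝟙-yes (0# ≟ 0#) refl) ⟩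
    q ^ d * 1                 ≡⟨ *-identityʳ (q ^ d) ⟩
    q ^ d                     ∎
    where open ≡-Reasoning

  #ker-nonzero : ∀ d {w : Vec d} → ¬ w ≗ 0ᵥ → q * #ker w ≡ q ^ d
  #ker-nonzero d {w} w≉0 = trans (cong (q *_) (#ker≡#solutions d w)) (#solutions-nonzero d w≉0 0# 0#)

  q^m∣#ker : ∀ {m d} → m < d → (w : Vec d) → q ^ m ∣ #ker w
  q^m∣#ker {m} {d} m<d w with m≤n⇒∃[o]m+o≡n m<d
  ... | k , refl with w ≟ᵥ 0ᵥ
  ...   | yes w≗0 = divides (q * q ^ k) (trans (#ker-zero (suc m + k) w≗0) (q^[1+m+k]≡ m k))
    where
    q^[1+m+k]≡ : ∀ m k → q ^ (suc m + k) ≡ q * q ^ k * q ^ m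
    q^[1+m+k]≡ m k = begin
      q * q ^ (m + k)     ≡⟨ cong (q *_) (^-distribˡ-+-* q m k) ⟩
      q * (q ^ m * q ^ k) ≡⟨ cong (q *_) (*-comm (q ^ m) (q ^ k)) ⟩
      q * (q ^ k * q ^ m) ≡⟨ *-assoc q (q ^ k) (q ^ m) ⟨
      q * q ^ k * q ^ m   ∎
      where open ≡-Reasoning
  ...   | no w≉0 = divides (q ^ k) (*-cancelˡ-≡ (#ker w) (q ^ k * q ^ m) q (begin
      q * #ker w            ≡⟨ #ker-nonzero (suc m + k) w≉0 ⟩
      q * q ^ (m + k)       ≡⟨ cong (q *_) (trans (^-distribˡ-+-* q m k) (*-comm (q ^ m) (q ^ k))) ⟩
      q * (q ^ k * q ^ m)   ∎))
    where open ≡-Reasoning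

  pencil-count : ∀ {n} (e a w : Vec n) →
    𝟙 (a · w ≟ 0#) + ∑[ x < q ] 𝟙 (pencil e a x · w ≟ 0#) ≡
    1 + q * (𝟙 (a · w ≟ 0#) * 𝟙 (e · w ≟ 0#))
  pencil-count e a w with a · w ≟ 0#
  ... | yes a·w≡0 = cong suc (begin
    ∑[ x < q ] 𝟙 (pencil e a x · w ≟ 0#)
      ≡⟨ sum-cong-≗ (λ x → cong (λ t → 𝟙 (t ≟ 0#)) (pencil·w≡e·w x)) ⟩
    ∑[ x < q ] 𝟙 (e · w ≟ 0#)
      ≡⟨ sum-const q _ ⟩
    q * 𝟙 (e · w ≟ 0#)
      ≡⟨ cong (q *_) (*-identityˡ _) ⟨
    q * (1 * 𝟙 (e · w ≟ 0#)) ∎)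
    where
    open ≡-Reasoning
    pencil·w≡e·w : ∀ x → pencil e a x · w ≡ e · w
    pencil·w≡e·w x = begin
      pencil e a x · w          ≡⟨ pencil-· e a w x ⟩
      e · w 𝔽.+ x 𝔽.* (a · w)   ≡⟨ cong (λ t → e · w 𝔽.+ x 𝔽.* t) a·w≡0 ⟩
      e · w 𝔽.+ x 𝔽.* 0#      ≡⟨ cong (e · w 𝔽.+_) (𝔽.zeroʳ x) ⟩
      e · w 𝔽.+ 0#            ≡⟨ 𝔽.+-identityʳ (e · w) ⟩
      e · w                     ∎
  ... | no a·w≢0 = begin
    ∑[ x < q ] 𝟙 (pencil e a x · w ≟ 0#)
      ≡⟨ sum-cong-≗ (λ x → cong (λ t → 𝟙 (t ≟ 0#)) (pencil-· e a w x)) ⟩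
    ∑[ x < q ] 𝟙 (e · w 𝔽.+ x 𝔽.* (a · w) ≟ 0#)
      ≡⟨ affine-count a·w≢0 (e · w) 0# ⟩
    1
      ≡⟨ cong suc (*-zeroʳ q) ⟨
    1 + q * 0 ∎
    where open ≡-Reasoning

module PartitionCounting {q : ℕ} (F : FiniteField q) {n : ℕ} (P : VectorSpace.VSP F n) where

  open VectorSpace F using (Vec; VSP; lincomb)
  open VSP P
  open LinearAlgebra F
  open VectorSums q

  ι : (i : Fin size) → Vec (dim i) → Vec n
  ι i c = lincomb c (basis i)

  #preimages : Vec n → Fin size → ℕ
  #preimages v i = ∑ᵥ (dim i) (λ c → 𝟙 (v ≟ᵥ ι i c))

  #preimages-member : ∀ {v} i {c₀} → v ≗ ι i c₀ → #preimages v i ≡ 1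
  #preimages-member {v} i {c₀} v≗ιc₀ =
    trans (∑ᵥ-cong (dim i) (λ c → 𝟙-cong (v ≟ᵥ ι i c) (c ≟ᵥ c₀) (c≗c₀ c) (v≗ιc c))) (∑ᵥ-𝟙-≟ᵥ c₀)
    where
    c≗c₀ : ∀ c → v ≗ ι i c → c ≗ c₀
    c≗c₀ c v≗ιc = lincomb-injective (indep i) c c₀ (λ j → trans (sym (v≗ιc j)) (v≗ιc₀ j))
    v≗ιc : ∀ c → c ≗ c₀ → v ≗ ι i c
    v≗ιc c c≗c₀ j = trans (v≗ιc₀ j) (sym (lincomb-cong (basis i) c≗c₀ j))

  #preimages-nonmember : ∀ {v} i → (∀ c → ¬ v ≗ ι i c) → #preimages v i ≡ 0
  #preimages-nonmember {v} i v∉ = ∑ᵥ-zero (dim i) (λ c → 𝟙-no (v ≟ᵥ ι i c) (v∉ c))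

  ∑-#preimages : ∀ v → ∑[ i < size ] #preimages v i + 𝟙 (v ≟ᵥ 0ᵥ) ≡ 1 + size * 𝟙 (v ≟ᵥ 0ᵥ)
  ∑-#preimages v with v ≟ᵥ 0ᵥ
  ... | yes v≗0 = begin
    ∑[ i < size ] #preimages v i + 1 ≡⟨ cong (_+ 1) (sum-cong-≗ (λ i → #preimages-member i (v≗ι0 i))) ⟩
    ∑[ i < size ] 1 + 1              ≡⟨ cong (_+ 1) (sum-const size 1) ⟩
    size * 1 + 1                     ≡⟨ +-comm (size * 1) 1 ⟩
    1 + size * 1                     ∎
    where
    open ≡-Reasoning
    v≗ι0 : ∀ i → v ≗ ι i 0ᵥ
    v≗ι0 i j = trans (v≗0 j) (sym (lincomb-zero (basis i) j))
  ... | no v≉0 with cover v v≉0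
  ...   | i₀ , (c₀ , v≗ιc₀) , unique = begin
    ∑[ i < size ] #preimages v i + 0 ≡⟨ cong (_+ 0) (sum-cong-≗ #preimages≡𝟙) ⟩
    ∑[ i < size ] 𝟙 (i ≟ i₀) + 0     ≡⟨ cong (_+ 0) (sum-𝟙-≟ i₀) ⟩
    1                                ≡⟨ cong (1 +_) (*-zeroʳ size) ⟨
    1 + size * 0                     ∎
    where
    open ≡-Reasoning
    #preimages≡𝟙 : ∀ i → #preimages v i ≡ 𝟙 (i ≟ i₀)
    #preimages≡𝟙 i with i ≟ i₀
    ... | yes refl = #preimages-member i₀ v≗ιc₀
    ... | no  i≢i₀ = #preimages-nonmember i (λ c v≗ιc → i≢i₀ (sym (unique (c , v≗ιc))))

  ∑ᵥ-#preimages : (g : Vec n → ℕ) → g Preserves _≗_ ⟶ _≡_ →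
                  ∀ i → ∑ᵥ n (λ v → #preimages v i * g v) ≡ ∑ᵥ (dim i) (g ∘ ι i)
  ∑ᵥ-#preimages g g-cong i = begin
    ∑ᵥ n (λ v → ∑ᵥ (dim i) (λ c → 𝟙 (v ≟ᵥ ι i c)) * g v)
      ≡⟨ ∑ᵥ-cong n (λ v → *-distribʳ-∑ᵥ (dim i) (g v) (λ c → 𝟙 (v ≟ᵥ ι i c))) ⟩
    ∑ᵥ n (λ v → ∑ᵥ (dim i) (λ c → 𝟙 (v ≟ᵥ ι i c) * g v))
      ≡⟨ ∑ᵥ-comm n (dim i) (λ v c → 𝟙 (v ≟ᵥ ι i c) * g v) ⟩
    ∑ᵥ (dim i) (λ c → ∑ᵥ n (λ v → 𝟙 (v ≟ᵥ ι i c) * g v))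
      ≡⟨ ∑ᵥ-cong (dim i) (λ c → ∑ᵥ-delta n (ι i c) g g-cong) ⟩
    ∑ᵥ (dim i) (g ∘ ι i) ∎
    where open ≡-Reasoning

  ∑ᵥ-partition : (g : Vec n → ℕ) → g Preserves _≗_ ⟶ _≡_ →
                 ∑ᵥ n g + size * g 0ᵥ ≡ g 0ᵥ + ∑[ i < size ] ∑ᵥ (dim i) (g ∘ ι i)
  ∑ᵥ-partition g g-cong = begin
    ∑ᵥ n g + size * g 0ᵥ
      ≡⟨ cong₂ _+_ (∑ᵥ-cong n (λ v → *-identityˡ (g v))) (cong (size *_) (∑ᵥ-delta n 0ᵥ g g-cong)) ⟨
    ∑ᵥ n (λ v → 1 * g v) + size * ∑ᵥ n (λ v → 𝟙 (v ≟ᵥ 0ᵥ) * g v)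
      ≡⟨ cong (∑ᵥ n (λ v → 1 * g v) +_) (*-distribˡ-∑ᵥ n size (λ v → 𝟙 (v ≟ᵥ 0ᵥ) * g v)) ⟩
    ∑ᵥ n (λ v → 1 * g v) + ∑ᵥ n (λ v → size * (𝟙 (v ≟ᵥ 0ᵥ) * g v))
      ≡⟨ ∑ᵥ-distrib-+ n (λ v → 1 * g v) (λ v → size * (𝟙 (v ≟ᵥ 0ᵥ) * g v)) ⟨
    ∑ᵥ n (λ v → 1 * g v + size * (𝟙 (v ≟ᵥ 0ᵥ) * g v))
      ≡⟨ ∑ᵥ-cong n (λ v → cong₂ _+_ refl (sym (*-assoc size (𝟙 (v ≟ᵥ 0ᵥ)) (g v)))) ⟩
    ∑ᵥ n (λ v → 1 * g v + size * 𝟙 (v ≟ᵥ 0ᵥ) * g v)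
      ≡⟨ ∑ᵥ-cong n (λ v → sym (*-distribʳ-+ (g v) 1 (size * 𝟙 (v ≟ᵥ 0ᵥ)))) ⟩
    ∑ᵥ n (λ v → (1 + size * 𝟙 (v ≟ᵥ 0ᵥ)) * g v)
      ≡⟨ ∑ᵥ-cong n (λ v → cong (_* g v) (∑-#preimages v)) ⟨
    ∑ᵥ n (λ v → (∑[ i < size ] #preimages v i + 𝟙 (v ≟ᵥ 0ᵥ)) * g v)
      ≡⟨ ∑ᵥ-cong n (λ v → *-distribʳ-+ (g v) (∑[ i < size ] #preimages v i) (𝟙 (v ≟ᵥ 0ᵥ))) ⟩
    ∑ᵥ n (λ v → ∑[ i < size ] #preimages v i * g v + 𝟙 (v ≟ᵥ 0ᵥ) * g v)
      ≡⟨ ∑ᵥ-distrib-+ n (λ v → ∑[ i < size ] #preimages v i * g v) (λ v → 𝟙 (v ≟ᵥ 0ᵥ) * g v) ⟩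
    ∑ᵥ n (λ v → ∑[ i < size ] #preimages v i * g v) + ∑ᵥ n (λ v → 𝟙 (v ≟ᵥ 0ᵥ) * g v)
      ≡⟨ cong₂ _+_ (∑ᵥ-cong n (λ v → *-distribʳ-sum (g v) (#preimages v))) (∑ᵥ-delta n 0ᵥ g g-cong) ⟩
    ∑ᵥ n (λ v → ∑[ i < size ] (#preimages v i * g v)) + g 0ᵥ
      ≡⟨ cong (_+ g 0ᵥ) (∑ᵥ-comm-∑ n (λ v i → #preimages v i * g v)) ⟩
    ∑[ i < size ] ∑ᵥ n (λ v → #preimages v i * g v) + g 0ᵥ
      ≡⟨ cong (_+ g 0ᵥ) (sum-cong-≗ (∑ᵥ-#preimages g g-cong)) ⟩
    ∑[ i < size ] ∑ᵥ (dim i) (g ∘ ι i) + g 0ᵥ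
      ≡⟨ +-comm _ (g 0ᵥ) ⟩
    g 0ᵥ + ∑[ i < size ] ∑ᵥ (dim i) (g ∘ ι i) ∎
    where open ≡-Reasoning

module HoleCount {q₁ : ℕ} (F : FiniteField (suc q₁)) {n : ℕ} (P : VectorSpace.VSP F n) (K r : ℕ)
  (0<r : 0 < r) (r<q^K : r < suc q₁ ^ K)
  (large-dims : ∀ i → VectorSpace.VSP.dim P i ≢ 1 → 2 + K ≤ VectorSpace.VSP.dim P i)
  (2+K≤n : 2 + K ≤ n)
  (#holes : ∑[ i < VectorSpace.VSP.size P ] 𝟙 (VectorSpace.VSP.dim P i ℕ.≟ 1) ≡ r + suc q₁ ^ (2 + K))
  where

  open VectorSpace F using (Vec)
  open VectorSpace.VSP P
  open LinearAlgebra F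
  open VectorSums (suc q₁)
  open Counting F
  open PartitionCounting F P

  q D : ℕ
  q = suc q₁
  D = q ^ suc K

  hole : ∀ i → Dec (dim i ≡ 1)
  hole i = dim i ℕ.≟ 1

  N : ℕ
  N = ∑[ i < size ] 𝟙 (hole i)

  -- For a hole i, u i spans member i.
  u : Fin size → Vec n
  u i = basis i (fromℕ< (dimPos i))

  u-nonzero : ∀ i → ¬ u i ≗ 0ᵥ
  u-nonzero i = LinIndep⇒nonzero (indep i) (fromℕ< (dimPos i))

  holesIn : Vec n → ℕ
  holesIn a = ∑[ i < size ] (𝟙 (hole i) * 𝟙 (a · u i ≟ 0#))

  hyperplane-identity : ∀ a → #ker a + size ≡ 1 + ∑[ i < size ] #ker (λ l → a · basis i l)
  hyperplane-identity a = begin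
    #ker a + size
      ≡⟨ cong₂ _+_ (∑ᵥ-cong n (λ v → cong (λ t → 𝟙 (t ≟ 0#)) (·-comm a v)))
                   (trans (cong (size *_) g0≡1) (*-identityʳ size)) ⟨
    ∑ᵥ n g + size * g 0ᵥ
      ≡⟨ ∑ᵥ-partition g g-cong ⟩
    g 0ᵥ + ∑[ i < size ] ∑ᵥ (dim i) (g ∘ ι i)
      ≡⟨ cong₂ _+_ g0≡1 (sum-cong-≗ (λ i → ∑ᵥ-cong (dim i) (λ c →
           cong (λ t → 𝟙 (t ≟ 0#)) (·-lincomb a c (basis i))))) ⟩
    1 + ∑[ i < size ] #ker (λ l → a · basis i l) ∎
    where
    open ≡-Reasoning
    g : Vec n → ℕ
    g v = 𝟙 (a · v ≟ 0#)
    g-cong : g Preserves _≗_ ⟶ _≡_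
    g-cong v≗w = cong (λ t → 𝟙 (t ≟ 0#)) (·-congʳ a v≗w)
    g0≡1 : g 0ᵥ ≡ 1
    g0≡1 = 𝟙-yes (a · 0ᵥ ≟ 0#) (·-zeroʳ a (λ _ → refl))

  #ker-hole : ∀ a i → dim i ≡ 1 → #ker (λ l → a · basis i l) ≡ 1 + q₁ * 𝟙 (a · u i ≟ 0#)
  #ker-hole a i dim≡1 with a · u i ≟ 0#
  ... | yes a·u≡0 = trans (#ker-zero (dim i) w≗0) (cong (q ^_) dim≡1)
    where
    w≗0 : (λ l → a · basis i l) ≗ 0ᵥ
    w≗0 l = trans (cong (λ l′ → a · basis i l′) (Fin-unique dim≡1 l (fromℕ< (dimPos i)))) a·u≡0
  ... | no a·u≢0 = *-cancelˡ-≡ _ _ q (begin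
    q * #ker (λ l → a · basis i l) ≡⟨ #ker-nonzero (dim i) (λ w≗0 → a·u≢0 (w≗0 (fromℕ< (dimPos i)))) ⟩
    q ^ dim i                      ≡⟨ cong (q ^_) dim≡1 ⟩
    q * 1                          ≡⟨ cong (λ t → q * suc t) (*-zeroʳ q₁) ⟨
    q * (1 + q₁ * 0)               ∎)
    where open ≡-Reasoning

  #ker-member : ∀ a i → #ker (λ l → a · basis i l) ≡ 𝟙 (hole i) + q₁ * (𝟙 (hole i) * 𝟙 (a · u i ≟ 0#)) mod D
  #ker-member a i with hole i
  ... | yes dim≡1 = ≡⇒≡-mod (trans (#ker-hole a i dim≡1) (cong (λ t → 1 + q₁ * t) (sym (*-identityˡ _))))
  ... | no  dim≢1 = ≡-mod-trans (∣⇒≡0-mod (q^m∣#ker (large-dims i dim≢1) _)) (≡⇒≡-mod (sym (*-zeroʳ q₁)))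

  size≡-mod : ∀ a → size ≡ 1 + N + q₁ * holesIn a mod D
  size≡-mod a = begin
    size                                         ≈⟨ +-cong-mod (∣⇒≡0-mod (q^m∣#ker 2+K≤n a)) (≡⇒≡-mod refl) ⟨
    #ker a + size                                ≡⟨ hyperplane-identity a ⟩
    1 + ∑[ i < size ] #ker (λ l → a · basis i l)  ≈⟨ +-cong-mod (≡⇒≡-mod refl) (sum-cong-mod (#ker-member a)) ⟩
    1 + ∑[ i < size ] (𝟙 (hole i) + q₁ * hole∩a⊥ i)
      ≡⟨ cong suc (trans (∑-distrib-+ (λ i → 𝟙 (hole i)) (λ i → q₁ * hole∩a⊥ i))
                         (cong (N +_) (sym (*-distribˡ-sum q₁ hole∩a⊥)))) ⟩
    1 + N + q₁ * holesIn a                       ∎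
    where
    open ≡-mod-Reasoning D
    hole∩a⊥ : Fin size → ℕ
    hole∩a⊥ i = 𝟙 (hole i) * 𝟙 (a · u i ≟ 0#)

  holesIn-0ᵥ : holesIn 0ᵥ ≡ N
  holesIn-0ᵥ = sum-cong-≗ (λ i →
    trans (cong (𝟙 (hole i) *_) (𝟙-yes (0ᵥ · u i ≟ 0#) (·-zeroˡ (u i)))) (*-identityʳ _))

  holesIn≡r-mod : ∀ a → holesIn a ≡ r mod D
  holesIn≡r-mod a = begin
    holesIn a  ≈⟨ unit-cancel-mod q₁ θ θ-eq (+-cancelˡ-mod (1 + N) q₁h≡q₁N) ⟩
    N          ≡⟨ #holes ⟩
    r + q * D  ≈⟨ +-multiple-mod r q ⟩
    r          ∎
    where
    open ≡-mod-Reasoning D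
    θ = proj₁ ([1+q₁]^m≡1+q₁*θ q₁ (suc K))
    θ-eq = proj₂ ([1+q₁]^m≡1+q₁*θ q₁ (suc K))
    q₁h≡q₁N : 1 + N + q₁ * holesIn a ≡ 1 + N + q₁ * N mod D
    q₁h≡q₁N = ≡-mod-trans (≡-mod-sym (size≡-mod a))
                          (subst (λ t → size ≡ 1 + N + q₁ * t mod D) holesIn-0ᵥ (size≡-mod 0ᵥ))

  holesIn≡r+jD : ∀ a → ∃[ j ] holesIn a ≡ r + j * D
  holesIn≡r+jD a = ≡-mod⇒≡+multiple (holesIn≡r-mod a) (<-≤-trans r<q^K (^-monoʳ-≤ q (n≤1+n K)))

  holesInAxis : Vec n → Vec n → ℕ
  holesInAxis e a = ∑[ i < size ] (𝟙 (hole i) * (𝟙 (a · u i ≟ 0#) * 𝟙 (e · u i ≟ 0#)))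

  pencil-identity : ∀ e a → holesIn a + ∑[ x < q ] holesIn (pencil e a x) ≡ N + q * holesInAxis e a
  pencil-identity e a = begin
    holesIn a + ∑[ x < q ] ∑[ i < size ] (𝟙 (hole i) * inPencil x i)
      ≡⟨ cong (holesIn a +_) (∑-comm (λ x i → 𝟙 (hole i) * inPencil x i)) ⟩
    holesIn a + ∑[ i < size ] ∑[ x < q ] (𝟙 (hole i) * inPencil x i)
      ≡⟨ cong (holesIn a +_) (sum-cong-≗ (λ i → *-distribˡ-sum (𝟙 (hole i)) (λ x → inPencil x i))) ⟨
    holesIn a + ∑[ i < size ] (𝟙 (hole i) * ∑[ x < q ] inPencil x i)
      ≡⟨ ∑-distrib-+ (λ i → 𝟙 (hole i) * 𝟙 (a · u i ≟ 0#)) (λ i → 𝟙 (hole i) * ∑[ x < q ] inPencil x i) ⟨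
    ∑[ i < size ] (𝟙 (hole i) * 𝟙 (a · u i ≟ 0#) + 𝟙 (hole i) * ∑[ x < q ] inPencil x i)
      ≡⟨ sum-cong-≗ (λ i → trans (sym (*-distribˡ-+ (𝟙 (hole i)) _ _))
                                 (cong (𝟙 (hole i) *_) (pencil-count e a (u i)))) ⟩
    ∑[ i < size ] (𝟙 (hole i) * (1 + q * inAxis i))
      ≡⟨ sum-cong-≗ (λ i → expand (𝟙 (hole i)) q (inAxis i)) ⟩
    ∑[ i < size ] (𝟙 (hole i) + q * (𝟙 (hole i) * inAxis i))
      ≡⟨ ∑-distrib-+ (λ i → 𝟙 (hole i)) (λ i → q * (𝟙 (hole i) * inAxis i)) ⟩
    N + ∑[ i < size ] (q * (𝟙 (hole i) * inAxis i))
      ≡⟨ cong (N +_) (*-distribˡ-sum q (λ i → 𝟙 (hole i) * inAxis i)) ⟨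
    N + q * holesInAxis e a ∎
    where
    open ≡-Reasoning
    inPencil : Fin q → Fin size → ℕ
    inPencil x i = 𝟙 (pencil e a x · u i ≟ 0#)
    inAxis : Fin size → ℕ
    inAxis i = 𝟙 (a · u i ≟ 0#) * 𝟙 (e · u i ≟ 0#)
    expand : ∀ h q x → h * (1 + q * x) ≡ h + q * (h * x)
    expand = solve-∀

  r≤holesInAxis : ∀ e a → holesIn a ≡ r → r ≤ holesInAxis e a
  r≤holesInAxis e a h≡r =
    let (j , axis≡r+j*q^K) = ≡-mod⇒≡+multiple axis≡r-mod r<q^K in
    ≤-trans (m≤m+n r (j * q ^ K)) (≤-reflexive (sym axis≡r+j*q^K))
    where
    pencil≡qr : ∑[ x < q ] holesIn (pencil e a x) ≡ q * r mod D
    pencil≡qr = ≡-mod-trans (sum-cong-mod (λ x → holesIn≡r-mod (pencil e a x))) (≡⇒≡-mod (sum-const q r))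
    axis≡r-mod : holesInAxis e a ≡ r mod q ^ K
    axis≡r-mod = ≡-mod-sym (*-cancelˡ-mod q (+-cancelˡ-mod r (begin
      r + q * r                                     ≈⟨ +-cong-mod (≡⇒≡-mod h≡r) pencil≡qr ⟨
      holesIn a + ∑[ x < q ] holesIn (pencil e a x) ≡⟨ pencil-identity e a ⟩
      N + q * holesInAxis e a                       ≡⟨ cong (_+ q * holesInAxis e a) #holes ⟩
      r + q * D + q * holesInAxis e a               ≈⟨ +-cong-mod (+-multiple-mod r q) (≡⇒≡-mod refl) ⟩
      r + q * holesInAxis e a                       ∎)))
      where open ≡-mod-Reasoning D

  holesInAxis<holesIn : ∀ e a i₀ → 0 < 𝟙 (hole i₀) * 𝟙 (a · u i₀ ≟ 0#) → e · u i₀ ≢ 0# →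
                        holesInAxis e a < holesIn a
  holesInAxis<holesIn e a i₀ i₀∈a⊥ i₀∉e⊥ = sum-mono-< axis≤ i₀ axis<
    where
    axis≤ : ∀ i → 𝟙 (hole i) * (𝟙 (a · u i ≟ 0#) * 𝟙 (e · u i ≟ 0#)) ≤ 𝟙 (hole i) * 𝟙 (a · u i ≟ 0#)
    axis≤ i = *-monoʳ-≤ (𝟙 (hole i)) (m*𝟙≤m (𝟙 (a · u i ≟ 0#)) (e · u i ≟ 0#))
    axis< : 𝟙 (hole i₀) * (𝟙 (a · u i₀ ≟ 0#) * 𝟙 (e · u i₀ ≟ 0#)) < 𝟙 (hole i₀) * 𝟙 (a · u i₀ ≟ 0#)
    axis< rewrite 𝟙-no (e · u i₀ ≟ 0#) i₀∉e⊥ | *-zeroʳ (𝟙 (a · u i₀ ≟ 0#)) | *-zeroʳ (𝟙 (hole i₀)) =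
      i₀∈a⊥

  holesIn≢r : ∀ a → holesIn a ≢ r
  holesIn≢r a h≡r with sum>0⇒ (λ i → 𝟙 (hole i) * 𝟙 (a · u i ≟ 0#)) (subst (0 <_) (sym h≡r) 0<r)
  ... | i₀ , i₀∈a⊥ with ¬∀⟶∃¬ n _ (λ j → u i₀ j ≟ 0#) (u-nonzero i₀)
  ...   | j₀ , u₀j₀≢0 = <-irrefl refl (begin-strict
    r                          ≤⟨ r≤holesInAxis (unit j₀) a h≡r ⟩
    holesInAxis (unit j₀) a    <⟨ holesInAxis<holesIn (unit j₀) a i₀ i₀∈a⊥ i₀∉e⊥ ⟩
    holesIn a                  ≡⟨ h≡r ⟩
    r                          ∎)
    where
    open ≤-Reasoning
    i₀∉e⊥ : unit j₀ · u i₀ ≢ 0#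
    i₀∉e⊥ = subst (_≢ 0#) (sym (unit-· j₀ (u i₀))) u₀j₀≢0

  r+D≤holesIn : ∀ a → r + D ≤ holesIn a
  r+D≤holesIn a = from-multiple (holesIn≡r+jD a)
    where
    from-multiple : ∃[ j ] holesIn a ≡ r + j * D → r + D ≤ holesIn a
    from-multiple (zero  , h≡r+0)      = ⊥-elim (holesIn≢r a (trans h≡r+0 (+-identityʳ r)))
    from-multiple (suc j , h≡r+[1+j]D) = ≤-trans (+-monoʳ-≤ r (m≤m+n D (j * D))) (≤-reflexive (sym h≡r+[1+j]D))

  q*∑holesIn : q * ∑ᵥ n holesIn ≡ N * q ^ n
  q*∑holesIn = begin
    q * ∑ᵥ n (λ a → ∑[ i < size ] (𝟙 (hole i) * 𝟙 (a · u i ≟ 0#)))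
      ≡⟨ cong (q *_) (∑ᵥ-comm-∑ n (λ a i → 𝟙 (hole i) * 𝟙 (a · u i ≟ 0#))) ⟩
    q * ∑[ i < size ] ∑ᵥ n (λ a → 𝟙 (hole i) * 𝟙 (a · u i ≟ 0#))
      ≡⟨ cong (q *_) (sum-cong-≗ (λ i → *-distribˡ-∑ᵥ n (𝟙 (hole i)) (λ a → 𝟙 (a · u i ≟ 0#)))) ⟨
    q * ∑[ i < size ] (𝟙 (hole i) * #ker (u i))
      ≡⟨ *-distribˡ-sum q (λ i → 𝟙 (hole i) * #ker (u i)) ⟩
    ∑[ i < size ] (q * (𝟙 (hole i) * #ker (u i)))
      ≡⟨ sum-cong-≗ (λ i → swap q (𝟙 (hole i)) (#ker (u i))) ⟩
    ∑[ i < size ] (𝟙 (hole i) * (q * #ker (u i)))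
      ≡⟨ sum-cong-≗ (λ i → cong (𝟙 (hole i) *_) (#ker-nonzero n (u-nonzero i))) ⟩
    ∑[ i < size ] (𝟙 (hole i) * q ^ n)
      ≡⟨ *-distribʳ-sum (q ^ n) (λ i → 𝟙 (hole i)) ⟨
    N * q ^ n ∎
    where
    open ≡-Reasoning
    swap : ∀ x y z → x * (y * z) ≡ y * (x * z)
    swap = solve-∀

  impossible : ⊥
  impossible = <⇒≱ r<q*r (+-cancelʳ-≤ (q * D) (q * r) r (*-cancelˡ-≤ (q ^ n) {{m^n≢0 q n}} averaged))
    where
    r<q*r : r < q * r
    r<q*r = subst (r <_) (*-comm r q) (m<m*n r q {{>-nonZero 0<r}} 1<q)
    averaged : q ^ n * (q * r + q * D) ≤ q ^ n * (r + q * D)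
    averaged = begin
      q ^ n * (q * r + q * D)   ≡⟨ regroup (q ^ n) q r D ⟩
      q * (q ^ n * (r + D))     ≡⟨ cong (q *_) (∑ᵥ-const n (r + D)) ⟨
      q * ∑ᵥ n (λ _ → r + D)    ≤⟨ *-monoʳ-≤ q (∑ᵥ-mono-≤ n r+D≤holesIn) ⟩
      q * ∑ᵥ n holesIn          ≡⟨ q*∑holesIn ⟩
      N * q ^ n                 ≡⟨ cong (_* q ^ n) #holes ⟩
      (r + q * D) * q ^ n       ≡⟨ *-comm (r + q * D) (q ^ n) ⟩
      q ^ n * (r + q * D)       ∎
      where
      open ≤-Reasoning
      regroup : ∀ Q q r D → Q * (q * r + q * D) ≡ q * (Q * (r + D))
      regroup = solve-∀

-- Needed only for the statement of lemma16; earlier it would clash with the vector _∷_ and [].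
open import Data.List using (_∷_; [])

module _ {q : ℕ} {F : FiniteField q} {n : ℕ} (P : VectorSpace.VSP F n) where

  open VectorSpace.VSP P

  mult≡∑𝟙 : ∀ d → mult d ≡ ∑[ i < size ] 𝟙 (dim i ℕ.≟ d)
  mult≡∑𝟙 d = length-filter-tabulate (λ i → dim i ℕ.≟ d) (λ i → i)

  0<mult-dim : ∀ i → 0 < mult (dim i)
  0<mult-dim i = begin-strict
    0                                       <⟨ s≤s z≤n ⟩
    1                                       ≡⟨ 𝟙-yes (dim i ℕ.≟ dim i) refl ⟨
    𝟙 (dim i ℕ.≟ dim i)                     ≤⟨ ≤-sum (λ i′ → 𝟙 (dim i′ ℕ.≟ dim i)) i ⟩
    ∑[ i′ < size ] 𝟙 (dim i′ ℕ.≟ dim i)     ≡⟨ mult≡∑𝟙 (dim i) ⟨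
    mult (dim i)                            ∎
    where open ≤-Reasoning

[1+2j+1]/2≡1+j : ∀ j → (suc (2 * j) + 1) / 2 ≡ suc j
[1+2j+1]/2≡1+j j = trans (cong (_/ 2) (1+2j+1≡[1+j]*2 j)) (m*n/n≡m (suc j) 2)
  where
  1+2j+1≡[1+j]*2 : ∀ j → suc (2 * j) + 1 ≡ suc j * 2
  1+2j+1≡[1+j]*2 = solve-∀

1+j<[1+2j]^K : ∀ {j K} → 1 < suc (2 * j) → 1 ≤ K → suc j < suc (2 * j) ^ K
1+j<[1+2j]^K {zero}  {K} (s≤s ()) 1≤K
1+j<[1+2j]^K {suc j} {K} _ 1≤K = begin-strict
  suc (suc j)              <⟨ s≤s (subst (suc j <_) (*-comm (suc j) 2) (m<m*n (suc j) 2 (s≤s (s≤s z≤n)))) ⟩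
  suc (2 * suc j)          ≡⟨ *-identityʳ (suc (2 * suc j)) ⟨
  suc (2 * suc j) ^ 1      ≤⟨ ^-monoʳ-≤ (suc (2 * suc j)) 1≤K ⟩
  suc (2 * suc j) ^ K      ∎
  where open ≤-Reasoning

lemma16 : (t k q : ℕ) → 1 ≤ t → 4 ≤ k → IsPrimePower q → Odd q →
    (F : FiniteField q) →
    let p = divℕ (q ^ (k * t + 2) ∸ q ^ 2) (q ^ k ∸ 1) + (q + 1) / 2
        m = divℕ (q ^ (k * (t + 1) + 2) ∸ q ^ 2) (q ^ k ∸ 1) ∸ (q ^ 2 ∸ 1) / 2
    in ¬ (Σ (VectorSpace.VSP F (k * (t + 1) + 1)) λ P →
            VectorSpace.HasType F P
              ((k , p ∸ 1) ∷ (k ∸ 1 , m ∸ p + 1) ∷ (1 , (q + 1) / 2 + q ^ (k ∸ 1)) ∷ []))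
lemma16 t .(3 + K) .(suc (2 * j)) _ (s≤s (s≤s (s≤s {n = K} 1≤K))) _ (j , refl) F (P , mult≡ , unlisted⇒mult≡0) =
  HoleCount.impossible F P K (suc j) (s≤s z≤n) (1+j<[1+2j]^K (LinearAlgebra.1<q F) 1≤K) large-dims 2+K≤n #holes
  where
  open VectorSpace.VSP P
  q : ℕ
  q = suc (2 * j)
  2+K≤n : 2 + K ≤ (3 + K) * (t + 1) + 1
  2+K≤n = ≤-trans (n≤1+n (2 + K)) (≤-trans (m≤m*n (3 + K) (t + 1) {{subst NonZero (+-comm 1 t) _}}) (m≤m+n _ 1))
  #holes : ∑[ i < size ] 𝟙 (dim i ℕ.≟ 1) ≡ suc j + q ^ (2 + K)
  #holes = begin
    ∑[ i < size ] 𝟙 (dim i ℕ.≟ 1)       ≡⟨ mult≡∑𝟙 P 1 ⟨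
    mult 1                              ≡⟨ mult≡ 1 _ (there (there (here refl))) ⟩
    (q + 1) / 2 + q ^ (2 + K)           ≡⟨ cong (_+ q ^ (2 + K)) ([1+2j+1]/2≡1+j j) ⟩
    suc j + q ^ (2 + K)                 ∎
    where open ≡-Reasoning
  large-dims : ∀ i → dim i ≢ 1 → 2 + K ≤ dim i
  large-dims i dim≢1 with dim i ℕ.≟ 3 + K | dim i ℕ.≟ 2 + K
  ... | yes dim≡k | _           = ≤-trans (n≤1+n (2 + K)) (≤-reflexive (sym dim≡k))
  ... | no  _     | yes dim≡k-1 = ≤-reflexive (sym dim≡k-1)
  ... | no  dim≢k | no dim≢k-1  = ⊥-elim (<⇒≢ (0<mult-dim P i) (sym (unlisted⇒mult≡0 (dim i) unlisted)))
    where
    unlisted : ¬ (∃[ m ] ((dim i , m) ∈ _))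
    unlisted (_ , here eq)                 = dim≢k (cong proj₁ eq)
    unlisted (_ , there (here eq))         = dim≢k-1 (cong proj₁ eq)
    unlisted (_ , there (there (here eq))) = dim≢1 (cong proj₁ eq)
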